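{- Let $a,b$ be indeterminates and let $m\geq 0$ be an integer. Define the bivariate Fibonacci polynomials $F_n(a,b)\in\mathbb{Z}[a,b]$ by $F_0(a,b):=0$ and $$F_{n+1}(a,b):=\sum_{k=0}^{\lfloor n/2\rfloor}\binom{n-k}{k}a^{n-2k}(-b)^k\quad(n\geq 0),$$ and define $L_n(a,b)\in\mathbb{Z}[a,b]$ as the unique solution of $x_{n+2}-ax_{n+1}+bx_n=0$ with $x_0=2$, $x_1=a$. Let $$f_{m+1}(x;a,b):=x^{2m+2}+\bigl[bF_m(a,b)-F_{m+2}(a,b)\bigr]x^{m+1}+b^{m+1}\in\mathbb{Z}[a,b][x].$$ Then $$f_{m+1}(x;a,b)=(x^2-ax+b)\left[\sum_{j=0}^{m-1}F_{j+1}(a,b)x^{2m-j}+\sum_{j=0}^{m}b^{m-j}F_{j+1}(a,b)x^{j}\right]=x^{2m+2}-L_{m+1}(a,b)x^{m+1}+b^{m+1}.$$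
   Context: For $m=0$ the first sum $\sum_{j=0}^{ -1}$ is empty. -}

module Defs where

open import Level using (Level)
open import Data.Nat using (ℕ; zero; suc; _∸_; ⌊_/2⌋) renaming (_+_ to _+ℕ_; _*_ to _*ℕ_)
open import Data.Nat.Combinatorics using (_C_)
open import Algebra.Bundles using (CommutativeRing; Semiring)

-- All objects are interpreted in an arbitrary commutative ring R; an identity
-- holding for all a b x in every commutative ring is exactly an identity in ℤ[a,b][x].
module Fib {c ℓ : Level} (R : CommutativeRing c ℓ) where
  open CommutativeRing R public
  open import Algebra.Definitions.RawSemiring (Semiring.rawSemiring semiring) public using (_×_; _^_)

  sumTo : ℕ → (ℕ → Carrier) → Carrier
  sumTo zero    f = 0#
  sumTo (suc n) f = sumTo n f + f n

  F : ℕ → Carrier → Carrier → Carrier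
  F zero    a b = 0#
  F (suc n) a b =
    sumTo (suc ⌊ n /2⌋) (λ k → ((n ∸ k) C k) × ((a ^ (n ∸ (2 *ℕ k))) * ((- b) ^ k)))

  L : ℕ → Carrier → Carrier → Carrier
  L zero          a b = 1# + 1#
  L (suc zero)    a b = a
  L (suc (suc n)) a b = a * L (suc n) a b - b * L n a b

  f : ℕ → Carrier → Carrier → Carrier → Carrier
  f m x a b = x ^ (2 *ℕ m +ℕ 2) + (b * F m a b - F (m +ℕ 2) a b) * x ^ (m +ℕ 1) + b ^ (m +ℕ 1)

-- Pascal's rule along the shallow diagonals of the binomial triangle shows that the
-- binomial sums F_n satisfy F_{n+2} = a F_{n+1} - b F_n with F_0 = 0, F_1 = 1. Then
-- n ↦ L_{n+1} and n ↦ F_{n+2} - b F_n solve the same recurrence with the same initial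
-- values, so they agree, which gives the second expression for f_{m+1}. Multiplying
-- either sum of the factorisation by x² - a x + b telescopes by the recurrence: the
-- first gives x^{2m+2} - F_{m+1} x^{m+2} + b F_m x^{m+1}, the second
-- b^{m+1} + F_{m+1} x^{m+2} - F_{m+2} x^{m+1}, and these add up to f_{m+1}.

module Submission where

open import Defs
open import Level using (Level)
open import Data.Nat
  using (ℕ; zero; suc; _≤_; _<_; _≤′_; ≤′-refl; ≤′-step; z≤n; s≤s; ⌊_/2⌋; _<?_)
  renaming (_+_ to _+ℕ_; _*_ to _*ℕ_; _∸_ to _∸ℕ_)
import Data.Nat.Properties as ℕ
open import Data.Nat.Combinatorics using (_C_; k>n⇒nCk≡0; nCk+nC[k+1]≡[n+1]C[k+1])
open import Data.Nat.Tactic.RingSolver using (solve-∀)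
open import Data.Integer as ℤ using (ℤ; +_; -[1+_]; _⊖_; sign; ∣_∣; _◃_)
import Data.Integer.Properties as ℤ
open import Data.Sign as Sign using (Sign)
open import Data.Product using (_,_; proj₁) renaming (_×_ to _∧_)
open import Data.Maybe using (Maybe; just; nothing)
open import Function using (_∘_)
open import Relation.Nullary using (yes; no)
open import Relation.Binary.PropositionalEquality as ≡ using (_≡_)
open import Algebra.Bundles using (CommutativeRing)
open import Algebra.Solver.Ring.AlmostCommutativeRing
  using (fromCommutativeRing; _-Raw-AlmostCommutative⟶_)

m<n⇒n∸m≡1+[n∸1+m] : ∀ {m n} → m < n → n ∸ℕ m ≡ suc (n ∸ℕ suc m)
m<n⇒n∸m≡1+[n∸1+m] {zero}  (s≤s _)   = ≡.refl
m<n⇒n∸m≡1+[n∸1+m] {suc m} (s≤s m<n) = m<n⇒n∸m≡1+[n∸1+m] m<n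

[1+n]∸k≤1+[n∸k] : ∀ n k → suc n ∸ℕ k ≤ suc (n ∸ℕ k)
[1+n]∸k≤1+[n∸k] n       zero    = ℕ.≤-refl
[1+n]∸k≤1+[n∸k] zero    (suc k) = ≡.subst (_≤ suc (0 ∸ℕ suc k)) (≡.sym (ℕ.0∸n≡0 k)) z≤n
[1+n]∸k≤1+[n∸k] (suc n) (suc k) = [1+n]∸k≤1+[n∸k] n k

⌊n/2⌋<k⇒n∸k<k : ∀ n k → ⌊ n /2⌋ < k → n ∸ℕ k < k
⌊n/2⌋<k⇒n∸k<k zero          k       0<k       = ≡.subst (_< k) (≡.sym (ℕ.0∸n≡0 k)) 0<k
⌊n/2⌋<k⇒n∸k<k (suc zero)    (suc k) _         = ≡.subst (_< suc k) (≡.sym (ℕ.0∸n≡0 k)) (s≤s z≤n)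
⌊n/2⌋<k⇒n∸k<k (suc (suc n)) (suc k) (s≤s h<k) =
  s≤s (ℕ.≤-trans ([1+n]∸k≤1+[n∸k] n k) (⌊n/2⌋<k⇒n∸k<k n k h<k))

[n∸k]C[1+k]≡0 : ∀ {n k} → n ≤ 2 *ℕ k → (n ∸ℕ k) C suc k ≡ 0
[n∸k]C[1+k]≡0 {n} {k} n≤2k = k>n⇒nCk≡0 (s≤s (ℕ.m≤n+o⇒m∸n≤o n k n≤k+k))
  where
  n≤k+k : n ≤ k +ℕ k
  n≤k+k = ≡.subst (λ o → n ≤ k +ℕ o) (ℕ.+-identityʳ k) n≤2k

[n∸k]Ck+[n∸k]C[1+k]≡[1+n∸k]C[1+k] : ∀ n k →
  (n ∸ℕ k) C k +ℕ (n ∸ℕ k) C suc k ≡ (suc n ∸ℕ k) C suc k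
[n∸k]Ck+[n∸k]C[1+k]≡[1+n∸k]C[1+k] n k with k ℕ.≤? n
... | yes k≤n rewrite ℕ.+-∸-assoc 1 k≤n = nCk+nC[k+1]≡[n+1]C[k+1] (n ∸ℕ k) k
... | no k≰n rewrite ℕ.m≤n⇒m∸n≡0 (ℕ.≰⇒> k≰n)
                   | ℕ.m≤n⇒m∸n≡0 (ℕ.<⇒≤ (ℕ.≰⇒> k≰n))
                   | k>n⇒nCk≡0 {0} {k} (ℕ.≤-trans (s≤s z≤n) (ℕ.≰⇒> k≰n)) = ≡.refl

2[1+m]∸j≡2+[2m∸j] : ∀ {m j} → j ≤ 2 *ℕ m → 2 *ℕ suc m ∸ℕ j ≡ suc (suc (2 *ℕ m ∸ℕ j))
2[1+m]∸j≡2+[2m∸j] {m} {j} j≤2m = ≡.trans (≡.cong (_∸ℕ j) (ℕ.*-suc 2 m)) (ℕ.+-∸-assoc 2 j≤2m)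

2m∸m≡m : ∀ m → 2 *ℕ m ∸ℕ m ≡ m
2m∸m≡m m = ≡.trans (ℕ.m+n∸m≡n m (m +ℕ 0)) (ℕ.+-identityʳ m)

2m+2≡[1+m]+[1+m] : ∀ m → 2 *ℕ m +ℕ 2 ≡ suc m +ℕ suc m
2m+2≡[1+m]+[1+m] = solve-∀

-- Algebra.Solver.Ring cancels terms only when it can decide equality of coefficients,
-- so it is instantiated with ℤ, which maps into every commutative ring.
module IntegerCoefficients {c ℓ : Level} (R : CommutativeRing c ℓ) where
  open CommutativeRing R
  open import Relation.Binary.Reasoning.Setoid setoid
  open import Algebra.Properties.Semiring.Mult.TCOptimised semiring using (_×_; 1+×; ×-homo-+; ×1-homo-*)
  open import Algebra.Properties.Ring ring using (-1*x≈-x)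
  open import Algebra.Properties.Group +-group using (ε⁻¹≈ε; ⁻¹-involutive)
  open import Algebra.Properties.AbelianGroup +-abelianGroup using (⁻¹-∙-comm)
  open import Algebra.Properties.CommutativeSemigroup +-commutativeSemigroup using (interchange)
  open import Algebra.Properties.CommutativeSemigroup *-commutativeSemigroup
    using () renaming (interchange to *-interchange)

  -- With the optimised multiplication the literals con (+ 0) and con (+ 1) of the solver
  -- evaluate to 0# and 1# definitionally.
  fromℤ : ℤ → Carrier
  fromℤ (+ n)    = n × 1#
  fromℤ -[1+ n ] = - (suc n × 1#)

  fromℤ-⊖ : ∀ m n → fromℤ (m ⊖ n) ≈ m × 1# - n × 1#
  fromℤ-⊖ zero    zero    = sym (-‿inverseʳ 0#)
  fromℤ-⊖ (suc m) zero    = sym (trans (+-congˡ ε⁻¹≈ε) (+-identityʳ _))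
  fromℤ-⊖ zero    (suc n) = sym (+-identityˡ _)
  fromℤ-⊖ (suc m) (suc n) = begin
    fromℤ (suc m ⊖ suc n)                   ≡⟨ ≡.cong fromℤ (ℤ.[1+m]⊖[1+n]≡m⊖n m n) ⟩
    fromℤ (m ⊖ n)                           ≈⟨ fromℤ-⊖ m n ⟩
    M - N                                   ≈⟨ +-identityˡ _ ⟨
    0# + (M - N)                            ≈⟨ +-congʳ (-‿inverseʳ 1#) ⟨
    (1# - 1#) + (M - N)                     ≈⟨ interchange 1# (- 1#) M (- N) ⟩
    (1# + M) + (- 1# - N)
      ≈⟨ +-cong (1+× m 1#) (trans (-‿cong (1+× n 1#)) (sym (⁻¹-∙-comm 1# N))) ⟨
    suc m × 1# - suc n × 1#                 ∎
    where
    M = m × 1#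
    N = n × 1#

  fromℤ-+ : ∀ i j → fromℤ (i ℤ.+ j) ≈ fromℤ i + fromℤ j
  fromℤ-+ (+ m)    (+ n)    = ×-homo-+ 1# m n
  fromℤ-+ (+ m)    -[1+ n ] = fromℤ-⊖ m (suc n)
  fromℤ-+ -[1+ m ] (+ n)    = trans (fromℤ-⊖ n (suc m)) (+-comm _ _)
  fromℤ-+ -[1+ m ] -[1+ n ] = begin
    - (suc (suc (m +ℕ n)) × 1#)        ≡⟨ ≡.cong (λ k → - (suc k × 1#)) (ℕ.+-suc m n) ⟨
    - ((suc m +ℕ suc n) × 1#)          ≈⟨ -‿cong (×-homo-+ 1# (suc m) (suc n)) ⟩
    - (suc m × 1# + suc n × 1#)        ≈⟨ ⁻¹-∙-comm _ _ ⟨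
    - (suc m × 1#) + - (suc n × 1#)    ∎

  fromℤ-neg : ∀ i → fromℤ (ℤ.- i) ≈ - fromℤ i
  fromℤ-neg -[1+ n ]    = sym (⁻¹-involutive _)
  fromℤ-neg (+ zero)    = sym ε⁻¹≈ε
  fromℤ-neg (+ (suc n)) = refl

  fromSign : Sign → Carrier
  fromSign Sign.+ = 1#
  fromSign Sign.- = - 1#

  fromSign-* : ∀ s t → fromSign (s Sign.* t) ≈ fromSign s * fromSign t
  fromSign-* Sign.+ t      = sym (*-identityˡ _)
  fromSign-* Sign.- Sign.+ = sym (*-identityʳ _)
  fromSign-* Sign.- Sign.- = sym (trans (-1*x≈-x _) (⁻¹-involutive _))

  fromℤ-◃ : ∀ s n → fromℤ (s ◃ n) ≈ fromSign s * (n × 1#)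
  fromℤ-◃ s      zero    = sym (zeroʳ _)
  fromℤ-◃ Sign.+ (suc n) = sym (*-identityˡ _)
  fromℤ-◃ Sign.- (suc n) = sym (-1*x≈-x _)

  fromℤ≈sign*abs : ∀ i → fromℤ i ≈ fromSign (sign i) * (∣ i ∣ × 1#)
  fromℤ≈sign*abs (+ n)    = sym (*-identityˡ _)
  fromℤ≈sign*abs -[1+ n ] = sym (-1*x≈-x _)

  fromℤ-* : ∀ i j → fromℤ (i ℤ.* j) ≈ fromℤ i * fromℤ j
  fromℤ-* i j = begin
    fromℤ (sign i Sign.* sign j ◃ ∣ i ∣ *ℕ ∣ j ∣)
      ≈⟨ fromℤ-◃ (sign i Sign.* sign j) (∣ i ∣ *ℕ ∣ j ∣) ⟩
    fromSign (sign i Sign.* sign j) * ((∣ i ∣ *ℕ ∣ j ∣) × 1#)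
      ≈⟨ *-cong (fromSign-* (sign i) (sign j)) (×1-homo-* ∣ i ∣ ∣ j ∣) ⟩
    (fromSign (sign i) * fromSign (sign j)) * ((∣ i ∣ × 1#) * (∣ j ∣ × 1#))
      ≈⟨ *-interchange _ _ _ _ ⟩
    (fromSign (sign i) * (∣ i ∣ × 1#)) * (fromSign (sign j) * (∣ j ∣ × 1#))
      ≈⟨ *-cong (fromℤ≈sign*abs i) (fromℤ≈sign*abs j) ⟨
    fromℤ i * fromℤ j ∎

  fromℤ-homomorphism : ℤ.+-*-rawRing -Raw-AlmostCommutative⟶ fromCommutativeRing R
  fromℤ-homomorphism = record
    { ⟦_⟧ = fromℤ ; +-homo = fromℤ-+ ; *-homo = fromℤ-* ; -‿homo = fromℤ-neg
    ; 0-homo = refl ; 1-homo = refl }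

  fromℤ-≟ : ∀ i j → Maybe (fromℤ i ≈ fromℤ j)
  fromℤ-≟ i j with i ℤ.≟ j
  ... | yes ≡.refl = just refl
  ... | no _       = nothing

  open import Algebra.Solver.Ring ℤ.+-*-rawRing (fromCommutativeRing R) fromℤ-homomorphism fromℤ-≟ public
    using (solve; _:=_; _:+_; _:*_; _:-_; _:^_; con)

module FibonacciLucas {c ℓ : Level} (R : CommutativeRing c ℓ) where
  open Fib R
  open IntegerCoefficients R
  open import Relation.Binary.Reasoning.Setoid setoid
  open import Algebra.Properties.Monoid.Mult +-monoid using (×-homo-+; ×-congʳ)
  open import Algebra.Properties.Semiring.Mult semiring using (×-comm-*)
  open import Algebra.Properties.Semiring.Exp semiring using (^-homo-*)
  open import Algebra.Properties.Ring ring using (-‿distribˡ-*)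
  open import Algebra.Properties.AbelianGroup +-abelianGroup using (⁻¹-anti-homo‿-)
  open import Algebra.Properties.CommutativeSemigroup +-commutativeSemigroup using (interchange)
  open import Algebra.Properties.CommutativeSemigroup *-commutativeSemigroup using (x∙yz≈y∙xz)

  sumTo-cong : ∀ n {f g : ℕ → Carrier} → (∀ k → k < n → f k ≈ g k) → sumTo n f ≈ sumTo n g
  sumTo-cong zero    f≈g = refl
  sumTo-cong (suc n) f≈g = +-cong (sumTo-cong n (λ k k<n → f≈g k (ℕ.m<n⇒m<1+n k<n))) (f≈g n (ℕ.n<1+n n))

  sumTo-+ : ∀ n (f g : ℕ → Carrier) → sumTo n (λ k → f k + g k) ≈ sumTo n f + sumTo n g
  sumTo-+ zero    f g = sym (+-identityʳ 0#)
  sumTo-+ (suc n) f g = trans (+-congʳ (sumTo-+ n f g)) (interchange _ _ _ _)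

  sumTo-*ˡ : ∀ n u (f : ℕ → Carrier) → sumTo n (λ k → u * f k) ≈ u * sumTo n f
  sumTo-*ˡ zero    u f = sym (zeroʳ u)
  sumTo-*ˡ (suc n) u f = trans (+-congʳ (sumTo-*ˡ n u f)) (sym (distribˡ u _ _))

  sumTo-suc : ∀ n (f : ℕ → Carrier) → sumTo (suc n) f ≈ f 0 + sumTo n (f ∘ suc)
  sumTo-suc zero    f = trans (+-identityˡ _) (sym (+-identityʳ _))
  sumTo-suc (suc n) f = trans (+-congʳ (sumTo-suc n f)) (+-assoc _ _ _)

  sumTo-extend : ∀ {m n} (f : ℕ → Carrier) → m ≤ n → (∀ k → m ≤ k → f k ≈ 0#) →
                 sumTo m f ≈ sumTo n f
  sumTo-extend {m} f m≤n vanish = go (ℕ.≤⇒≤′ m≤n)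
    where
    go : ∀ {n} → m ≤′ n → sumTo m f ≈ sumTo n f
    go ≤′-refl          = refl
    go (≤′-step {n} m≤′n) = begin
      sumTo m f          ≈⟨ go m≤′n ⟩
      sumTo n f          ≈⟨ +-identityʳ _ ⟨
      sumTo n f + 0#     ≈⟨ +-congˡ (vanish n (ℕ.≤′⇒≤ m≤′n)) ⟨
      sumTo n f + f n    ∎

  ×-pullˡ : ∀ n {u z w} → z ≈ u * w → n × z ≈ u * (n × w)
  ×-pullˡ n {u} {z} {w} z≈uw = trans (×-congʳ n z≈uw) (sym (×-comm-* n u w))

  module _ (a b : Carrier) where

    term : ℕ → ℕ → Carrier
    term n k = ((n ∸ℕ k) C k) × (a ^ (n ∸ℕ 2 *ℕ k) * (- b) ^ k)

    term-vanishes : ∀ n k → ⌊ n /2⌋ < k → term n k ≈ 0#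
    term-vanishes n k h<k =
      reflexive (≡.cong (_× (a ^ (n ∸ℕ 2 *ℕ k) * (- b) ^ k)) (k>n⇒nCk≡0 (⌊n/2⌋<k⇒n∸k<k n k h<k)))

    F-as-sum : ∀ n N → ⌊ n /2⌋ < N → F (suc n) a b ≈ sumTo N (term n)
    F-as-sum n N h<N = sumTo-extend (term n) h<N (λ k h<k → term-vanishes n k h<k)

    term-suc-zero : ∀ n → term (suc n) 0 ≈ a * term n 0
    term-suc-zero n = ×-pullˡ 1 (*-assoc a (a ^ n) 1#)

    -- If the binomial coefficient is nonzero then n > 2k, so a factor a can be split off.
    a-absorption : ∀ n k y →
      ((n ∸ℕ k) C suc k) × (a ^ (n ∸ℕ 2 *ℕ k) * y)
        ≈ a * (((n ∸ℕ k) C suc k) × (a ^ (n ∸ℕ suc (2 *ℕ k)) * y))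
    a-absorption n k y with 2 *ℕ k <? n
    ... | yes 2k<n rewrite m<n⇒n∸m≡1+[n∸1+m] 2k<n = ×-pullˡ ((n ∸ℕ k) C suc k) (*-assoc a _ y)
    ... | no 2k≮n  = trans (vanishing _) (sym (trans (*-congˡ (vanishing _)) (zeroʳ a)))
      where
      vanishing : ∀ z → ((n ∸ℕ k) C suc k) × z ≈ 0#
      vanishing z = reflexive (≡.cong (_× z) ([n∸k]C[1+k]≡0 {n} {k} (ℕ.≮⇒≥ 2k≮n)))

    term-suc-suc : ∀ n k → term (suc (suc n)) (suc k) ≈ a * term (suc n) (suc k) + (- b) * term n k
    term-suc-suc n k = begin
      term (suc (suc n)) (suc k)
        ≡⟨ ≡.cong₂ (λ c e → c × (a ^ (suc (suc n) ∸ℕ e) * (- b) ^ suc k))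
             (≡.sym ([n∸k]Ck+[n∸k]C[1+k]≡[1+n∸k]C[1+k] n k)) (ℕ.*-suc 2 k) ⟩
      (c₀ +ℕ c₁) × (a ^ (n ∸ℕ 2 *ℕ k) * (- b) ^ suc k)
        ≈⟨ ×-homo-+ _ c₀ c₁ ⟩
      c₀ × (a ^ (n ∸ℕ 2 *ℕ k) * (- b) ^ suc k) + c₁ × (a ^ (n ∸ℕ 2 *ℕ k) * (- b) ^ suc k)
        ≈⟨ +-comm _ _ ⟩
      c₁ × (a ^ (n ∸ℕ 2 *ℕ k) * (- b) ^ suc k) + c₀ × (a ^ (n ∸ℕ 2 *ℕ k) * (- b) ^ suc k)
        ≈⟨ +-cong (a-absorption n k ((- b) ^ suc k)) (×-pullˡ c₀ (x∙yz≈y∙xz _ _ _)) ⟩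
      a * (c₁ × (a ^ (n ∸ℕ suc (2 *ℕ k)) * (- b) ^ suc k)) + (- b) * term n k
        ≡⟨ ≡.cong (λ e → a * (c₁ × (a ^ (suc n ∸ℕ e) * (- b) ^ suc k)) + (- b) * term n k)
                  (ℕ.*-suc 2 k) ⟨
      a * term (suc n) (suc k) + (- b) * term n k ∎
      where
      c₀ = (n ∸ℕ k) C k
      c₁ = (n ∸ℕ k) C suc k

    sumTo-term-suc-suc : ∀ n N →
      sumTo (suc N) (term (suc (suc n))) ≈ a * sumTo (suc N) (term (suc n)) + (- b) * sumTo N (term n)
    sumTo-term-suc-suc n N = begin
      sumTo (suc N) (term (suc (suc n)))
        ≈⟨ sumTo-suc N _ ⟩
      term (suc (suc n)) 0 + sumTo N (term (suc (suc n)) ∘ suc)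
        ≈⟨ +-cong (term-suc-zero (suc n)) (sumTo-cong N (λ k _ → term-suc-suc n k)) ⟩
      a * term (suc n) 0 + sumTo N (λ k → a * term (suc n) (suc k) + (- b) * term n k)
        ≈⟨ +-congˡ (trans (sumTo-+ N _ _) (+-cong (sumTo-*ˡ N a _) (sumTo-*ˡ N (- b) _))) ⟩
      a * term (suc n) 0 + (a * sumTo N (term (suc n) ∘ suc) + (- b) * sumTo N (term n))
        ≈⟨ trans (+-congʳ (distribˡ a _ _)) (+-assoc _ _ _) ⟨
      a * (term (suc n) 0 + sumTo N (term (suc n) ∘ suc)) + (- b) * sumTo N (term n)
        ≈⟨ +-congʳ (*-congˡ (sumTo-suc N _)) ⟨
      a * sumTo (suc N) (term (suc n)) + (- b) * sumTo N (term n) ∎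

    F[1]≈1 : F 1 a b ≈ 1#
    F[1]≈1 = trans (+-identityˡ _) (trans (+-identityʳ _) (*-identityˡ 1#))

    F-recurrence : ∀ n → F (suc (suc n)) a b ≈ a * F (suc n) a b - b * F n a b
    F-recurrence zero = trans (+-congˡ (term-suc-zero 0))
      (solve 3 (λ a b t → con (+ 0) :+ a :* t := a :* (con (+ 0) :+ t) :- b :* con (+ 0)) refl a b (term 0 0))
    F-recurrence (suc n) = begin
      F (suc (suc (suc n))) a b
        ≈⟨ F-as-sum (suc (suc n)) (suc (suc (suc n))) (s≤s (ℕ.⌊n/2⌋≤n _)) ⟩
      sumTo (suc (suc (suc n))) (term (suc (suc n)))
        ≈⟨ sumTo-term-suc-suc n (suc (suc n)) ⟩
      a * sumTo (suc (suc (suc n))) (term (suc n)) + (- b) * sumTo (suc (suc n)) (term n)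
        ≈⟨ +-cong (*-congˡ (F-as-sum (suc n) _ (ℕ.m<n⇒m<1+n (s≤s (ℕ.⌊n/2⌋≤n _)))))
                  (*-congˡ (F-as-sum n _ (ℕ.m<n⇒m<1+n (s≤s (ℕ.⌊n/2⌋≤n _))))) ⟨
      a * F (suc (suc n)) a b + (- b) * F (suc n) a b
        ≈⟨ +-congˡ (-‿distribˡ-* b _) ⟨
      a * F (suc (suc n)) a b - b * F (suc n) a b ∎

    F[2]≈a : F 2 a b ≈ a
    F[2]≈a = trans (F-recurrence 0) (trans (+-congʳ (*-congˡ F[1]≈1))
      (solve 2 (λ a b → a :* con (+ 1) :- b :* con (+ 0) := a) refl a b))

    Recurrent : (ℕ → Carrier) → Set ℓ
    Recurrent u = ∀ n → u (suc (suc n)) ≈ a * u (suc n) - b * u n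

    recurrent-unique : ∀ {u v} → Recurrent u → Recurrent v →
                       u 0 ≈ v 0 → u 1 ≈ v 1 → ∀ n → u n ≈ v n
    recurrent-unique {u} {v} ru rv u₀≈v₀ u₁≈v₁ n = proj₁ (agree n)
      where
      agree : ∀ n → u n ≈ v n ∧ u (suc n) ≈ v (suc n)
      agree zero    = u₀≈v₀ , u₁≈v₁
      agree (suc n) with agree n
      ... | uₙ≈vₙ , uₙ₊₁≈vₙ₊₁ =
        uₙ₊₁≈vₙ₊₁ ,
        trans (ru n) (trans (+-cong (*-congˡ uₙ₊₁≈vₙ₊₁) (-‿cong (*-congˡ uₙ≈vₙ))) (sym (rv n)))

    recurrent-combination : ∀ {u v} w → Recurrent u → Recurrent v → Recurrent (λ n → u n - w * v n)
    recurrent-combination {u} {v} w ru rv n = trans (+-cong (ru n) (-‿cong (*-congˡ (rv n))))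
      (solve 7 (λ a b w u₀ u₁ v₀ v₁ → (a :* u₁ :- b :* u₀) :- w :* (a :* v₁ :- b :* v₀)
                                    := a :* (u₁ :- w :* v₁) :- b :* (u₀ :- w :* v₀))
             refl a b w (u n) (u (suc n)) (v n) (v (suc n)))

    L[1+n]≈F[2+n]-bF[n] : ∀ n → L (suc n) a b ≈ F (suc (suc n)) a b - b * F n a b
    L[1+n]≈F[2+n]-bF[n] = recurrent-unique (λ _ → refl)
      (recurrent-combination {u = λ n → F (suc (suc n)) a b} {v = λ n → F n a b} b
                             (F-recurrence ∘ suc ∘ suc) F-recurrence)
      (sym (trans (+-congʳ F[2]≈a) (solve 2 (λ a b → a :- b :* con (+ 0) := a) refl a b)))
      (sym (begin
        F 3 a b - b * F 1 a b                 ≈⟨ +-congʳ (F-recurrence 1) ⟩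
        (a * F 2 a b - b * F 1 a b) - b * F 1 a b
          ≈⟨ +-cong (+-cong (*-congˡ F[2]≈a) (-‿cong (*-congˡ F[1]≈1))) (-‿cong (*-congˡ F[1]≈1)) ⟩
        (a * a - b * 1#) - b * 1#
          ≈⟨ solve 3 (λ a b e → (a :* a :- b :* e) :- b :* e := a :* a :- b :* (e :+ e)) refl a b 1# ⟩
        a * a - b * (1# + 1#)                 ∎))

    module _ (x : Carrier) where

      χ : Carrier
      χ = x ^ 2 - a * x + b

      upperTerm lowerTerm : ℕ → ℕ → Carrier
      upperTerm m j = F (j +ℕ 1) a b * x ^ (2 *ℕ m ∸ℕ j)
      lowerTerm m j = b ^ (m ∸ℕ j) * F (j +ℕ 1) a b * x ^ j

      upperSum lowerSum : ℕ → Carrier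
      upperSum m = sumTo m (upperTerm m)
      lowerSum m = sumTo (m +ℕ 1) (lowerTerm m)

      upperSum-suc : ∀ m → upperSum (suc m) ≈ x ^ 2 * upperSum m + F (suc m) a b * x ^ suc (suc m)
      upperSum-suc m = +-cong (trans (sumTo-cong m shift) (sumTo-*ˡ m (x ^ 2) (upperTerm m))) last
        where
        shift : ∀ j → j < m → upperTerm (suc m) j ≈ x ^ 2 * upperTerm m j
        shift j j<m = trans (*-congˡ (reflexive (≡.cong (x ^_) (2[1+m]∸j≡2+[2m∸j] j≤2m))))
                            (solve 3 (λ x f y → f :* (x :* (x :* y)) := (x :^ 2) :* (f :* y)) refl x _ _)
          where
          j≤2m : j ≤ 2 *ℕ m
          j≤2m = ℕ.≤-trans (ℕ.<⇒≤ j<m) (ℕ.m≤m+n m (m +ℕ 0))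
        last : upperTerm (suc m) m ≈ F (suc m) a b * x ^ suc (suc m)
        last = reflexive (≡.cong₂ (λ i e → F i a b * x ^ e) (ℕ.+-comm m 1)
          (≡.trans (2[1+m]∸j≡2+[2m∸j] (ℕ.m≤m+n m (m +ℕ 0))) (≡.cong (suc ∘ suc) (2m∸m≡m m))))

      lowerTerm-diagonal : ∀ m → lowerTerm m m ≈ F (suc m) a b * x ^ m
      lowerTerm-diagonal m = trans
        (reflexive (≡.cong₂ (λ e i → b ^ e * F i a b * x ^ m) (ℕ.n∸n≡0 m) (ℕ.+-comm m 1)))
        (*-congʳ (*-identityˡ _))

      lowerSum-suc : ∀ m → lowerSum (suc m) ≈ b * lowerSum m + F (suc (suc m)) a b * x ^ suc m
      lowerSum-suc m = +-cong (trans (sumTo-cong (m +ℕ 1) shift) (sumTo-*ˡ (m +ℕ 1) b (lowerTerm m)))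
        (trans (reflexive (≡.cong (lowerTerm (suc m)) (ℕ.+-comm m 1))) (lowerTerm-diagonal (suc m)))
        where
        shift : ∀ j → j < m +ℕ 1 → lowerTerm (suc m) j ≈ b * lowerTerm m j
        shift j j<m+1 = trans
          (reflexive (≡.cong (λ e → b ^ e * F (j +ℕ 1) a b * x ^ j) (ℕ.+-∸-assoc 1 j≤m)))
          (trans (*-congʳ (*-assoc _ _ _)) (*-assoc _ _ _))
          where
          j≤m : j ≤ m
          j≤m = ℕ.m<1+n⇒m≤n (≡.subst (j <_) (ℕ.+-comm m 1) j<m+1)

      χ-step : ∀ {u U T E} → χ * U ≈ E → χ * (u * U + T) ≈ u * E + χ * T
      χ-step {u} {U} χU≈E = trans (distribˡ χ _ _) (+-congʳ (trans (x∙yz≈y∙xz χ u U) (*-congˡ χU≈E)))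

      χ*upperSum : ∀ m →
        χ * upperSum m ≈ x ^ suc m * x ^ suc m - F (suc m) a b * x ^ suc (suc m) + b * F m a b * x ^ suc m
      χ*upperSum zero = trans (zeroʳ χ) (trans
        (solve 2 (λ x b → con (+ 0) := (x :* con (+ 1)) :* (x :* con (+ 1)) :- con (+ 1) :* (x :* (x :* con (+ 1)))
                                      :+ b :* con (+ 0) :* (x :* con (+ 1))) refl x b)
        (+-congʳ (+-congˡ (-‿cong (*-congʳ (sym F[1]≈1))))))
      χ*upperSum (suc m) = begin
        χ * upperSum (suc m)                                    ≈⟨ *-congˡ (upperSum-suc m) ⟩
        χ * (x ^ 2 * upperSum m + F₁ * (x * Y))                 ≈⟨ χ-step (χ*upperSum m) ⟩
        x ^ 2 * (Y * Y - F₁ * (x * Y) + b * F₀ * Y) + χ * (F₁ * (x * Y))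
          ≈⟨ solve 6 (λ x a b y f₀ f₁ → (x :^ 2) :* (y :* y :- f₁ :* (x :* y) :+ b :* f₀ :* y)
                                          :+ ((x :^ 2) :- a :* x :+ b) :* (f₁ :* (x :* y))
                                        := (x :* y) :* (x :* y) :- (a :* f₁ :- b :* f₀) :* (x :* (x :* y))
                                          :+ b :* f₁ :* (x :* y)) refl x a b Y F₀ F₁ ⟩
        (x * Y) * (x * Y) - (a * F₁ - b * F₀) * (x * (x * Y)) + b * F₁ * (x * Y)
          ≈⟨ +-congʳ (+-congˡ (-‿cong (*-congʳ (F-recurrence m)))) ⟨
        (x * Y) * (x * Y) - F (suc (suc m)) a b * (x * (x * Y)) + b * F₁ * (x * Y) ∎
        where
        Y  = x ^ suc m
        F₀ = F m a b
        F₁ = F (suc m) a b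

      χ*lowerSum : ∀ m →
        χ * lowerSum m ≈ b ^ suc m + F (suc m) a b * x ^ suc (suc m) - F (suc (suc m)) a b * x ^ suc m
      χ*lowerSum zero = begin
        χ * (0# + 1# * F 1 a b * 1#)        ≈⟨ *-congˡ (+-congˡ (*-congʳ (*-congˡ F[1]≈1))) ⟩
        χ * (0# + 1# * 1# * 1#)
          ≈⟨ solve 3 (λ x a b → ((x :^ 2) :- a :* x :+ b) :* (con (+ 0) :+ con (+ 1) :* con (+ 1) :* con (+ 1))
                             := b :* con (+ 1) :+ con (+ 1) :* (x :* (x :* con (+ 1))) :- a :* (x :* con (+ 1)))
                    refl x a b ⟩
        b * 1# + 1# * (x * (x * 1#)) - a * (x * 1#)
          ≈⟨ +-cong (+-congˡ (*-congʳ F[1]≈1)) (-‿cong (*-congʳ F[2]≈a)) ⟨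
        b * 1# + F 1 a b * (x * (x * 1#)) - F 2 a b * (x * 1#) ∎
      χ*lowerSum (suc m) = begin
        χ * lowerSum (suc m)                                    ≈⟨ *-congˡ (lowerSum-suc m) ⟩
        χ * (b * lowerSum m + F₂ * Y)                           ≈⟨ χ-step (χ*lowerSum m) ⟩
        b * (B + F₁ * (x * Y) - F₂ * Y) + χ * (F₂ * Y)
          ≈⟨ solve 7 (λ x a b y B f₁ f₂ → b :* (B :+ f₁ :* (x :* y) :- f₂ :* y)
                                          :+ ((x :^ 2) :- a :* x :+ b) :* (f₂ :* y)
                                        := b :* B :+ f₂ :* (x :* (x :* y)) :- (a :* f₂ :- b :* f₁) :* (x :* y))
                    refl x a b Y B F₁ F₂ ⟩
        b * B + F₂ * (x * (x * Y)) - (a * F₂ - b * F₁) * (x * Y)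
          ≈⟨ +-congˡ (-‿cong (*-congʳ (F-recurrence (suc m)))) ⟨
        b * B + F₂ * (x * (x * Y)) - F (suc (suc (suc m))) a b * (x * Y) ∎
        where
        Y  = x ^ suc m
        B  = b ^ suc m
        F₁ = F (suc m) a b
        F₂ = F (suc (suc m)) a b

      f-in-powers-of-x^[1+m] : ∀ m →
        f m x a b ≈ x ^ suc m * x ^ suc m + (b * F m a b - F (suc (suc m)) a b) * x ^ suc m + b ^ suc m
      f-in-powers-of-x^[1+m] m = +-cong
        (+-cong (trans (reflexive (≡.cong (x ^_) (2m+2≡[1+m]+[1+m] m))) (^-homo-* x (suc m) (suc m)))
                (*-cong (+-congˡ (-‿cong (reflexive (≡.cong (λ i → F i a b) (ℕ.+-comm m 2)))))
                        (reflexive (≡.cong (x ^_) (ℕ.+-comm m 1)))))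
        (reflexive (≡.cong (b ^_) (ℕ.+-comm m 1)))

      f-factorisation : ∀ m → f m x a b ≈ χ * (upperSum m + lowerSum m)
      f-factorisation m = begin
        f m x a b                                               ≈⟨ f-in-powers-of-x^[1+m] m ⟩
        Y * Y + (b * F₀ - F₂) * Y + B
          ≈⟨ solve 7 (λ x b y B f₀ f₁ f₂ → y :* y :+ (b :* f₀ :- f₂) :* y :+ B
                                         := (y :* y :- f₁ :* (x :* y) :+ b :* f₀ :* y)
                                            :+ (B :+ f₁ :* (x :* y) :- f₂ :* y))
                    refl x b Y B F₀ F₁ F₂ ⟩
        (Y * Y - F₁ * (x * Y) + b * F₀ * Y) + (B + F₁ * (x * Y) - F₂ * Y)
          ≈⟨ +-cong (χ*upperSum m) (χ*lowerSum m) ⟨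
        χ * upperSum m + χ * lowerSum m                         ≈⟨ distribˡ χ _ _ ⟨
        χ * (upperSum m + lowerSum m)                           ∎
        where
        Y  = x ^ suc m
        B  = b ^ suc m
        F₀ = F m a b
        F₁ = F (suc m) a b
        F₂ = F (suc (suc m)) a b

      f-Lucas : ∀ m → f m x a b ≈ x ^ (2 *ℕ m +ℕ 2) - L (m +ℕ 1) a b * x ^ (m +ℕ 1) + b ^ (m +ℕ 1)
      f-Lucas m = +-congʳ (+-congˡ (trans (*-congʳ coefficient) (sym (-‿distribˡ-* _ _))))
        where
        lucas : L (m +ℕ 1) a b ≈ F (m +ℕ 2) a b - b * F m a b
        lucas = trans (reflexive (≡.cong (λ i → L i a b) (ℕ.+-comm m 1)))
          (trans (L[1+n]≈F[2+n]-bF[n] m) (reflexive (≡.cong (λ i → F i a b - b * F m a b) (ℕ.+-comm 2 m))))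
        coefficient : b * F m a b - F (m +ℕ 2) a b ≈ - L (m +ℕ 1) a b
        coefficient = trans (sym (⁻¹-anti-homo‿- _ _)) (-‿cong (sym lucas))

theorem1p2 : ∀ {c ℓ : Level} (R : CommutativeRing c ℓ) →
    let open Fib R in
    ∀ (m : ℕ) (a b x : Carrier) →
      (f m x a b ≈ (x ^ 2 - a * x + b) *
          (sumTo m (λ j → F (j +ℕ 1) a b * x ^ (2 *ℕ m ∸ℕ j))
           + sumTo (m +ℕ 1) (λ j → b ^ (m ∸ℕ j) * F (j +ℕ 1) a b * x ^ j)))
      ∧ (f m x a b ≈ x ^ (2 *ℕ m +ℕ 2) - L (m +ℕ 1) a b * x ^ (m +ℕ 1) + b ^ (m +ℕ 1))
theorem1p2 R m a b x = f-factorisation a b x m , f-Lucas a b x m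
  where open FibonacciLucas R
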